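{- For integers $n\ge1$ and $0\le i,j\le n$ define \[ w^n_j[i]=\sum_{r=0}^{i}(-1)^r\binom{n+1}{r}(2i-2r+1)^{n-j} \] (the same formula is used to define $w^{n-1}_{j-1}[i]$ for $0\le i\le n$). Then $w^n_j[i]=w^{n-1}_{j-1}[i]-w^{n-1}_{j-1}[i-1]$ for all $1\le i,j\le n$. Moreover $w^n_0[i]=\overline{A(n,i)}$ for $0\le i\le n$, and $w^n_j[n]=(-1)^j$ for $0\le j\le n$.
   Context: A signed permutation on $n$ symbols is a bijection $\sigma$ of $\{\pm1,\dots,\pm n\}$ with $\sigma(-k)=-\sigma(k)$, written as the word $\sigma(1)\cdots\sigma(n)$. Use the linear order $1<2<\cdots<n<-n<\cdots<-2<-1$. $\sigma$ has a descent at position $i$ ($1\le i\le n-1$) if $\sigma(i)>\sigma(i+1)$ in this order, and a descent at position $n$ if $\sigma(n)<0$. $\overline{A(n,k)}$ denotes the number of signed permutations on $n$ symbols with exactly $k$ descents. -}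

module Defs where

open import Data.Bool using (Bool; true; false; if_then_else_)
open import Data.Nat as ℕ using (ℕ; zero; suc; _∸_; _<?_)
open import Data.Nat.Combinatorics using (_C_)
open import Data.Integer as ℤ using (ℤ; +_; -_; _-_)
open import Data.Fin using (Fin; toℕ)
open import Data.Fin.Properties using (_≟_)
open import Data.List using (List; []; _∷_; map; foldr; upTo; concatMap; filter; length; allFin; cartesianProduct)
open import Data.List.Relation.Unary.AllPairs using (AllPairs; allPairs?)
open import Data.Vec using (Vec; toList) renaming ([] to []ᵥ; _∷_ to _∷ᵥ_)
open import Data.Product using (_×_; _,_; proj₂)
open import Relation.Nullary using (does; ¬?)
open import Relation.Nullary.Decidable using (⌊_⌋)
open import Relation.Unary using (Decidable)
open import Relation.Binary.PropositionalEquality using (_≢_)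

sumTo : ℕ → (ℕ → ℤ) → ℤ
sumTo i f = foldr ℤ._+_ (+ 0) (map f (upTo (suc i)))

-- w^n_j[i] = Σ_{r=0}^{i} (-1)^r C(n+1,r) (2i-2r+1)^(n-j)
-- (for r ≤ i, 2i-2r+1 is computed in ℕ without truncation)
w : (n j i : ℕ) → ℤ
w n j i = sumTo i (λ r → ((- + 1) ℤ.^ r) ℤ.* (+ (suc n C r)) ℤ.* (+ ((2 ℕ.* i ∸ 2 ℕ.* r ℕ.+ 1) ℕ.^ (n ∸ j))))

-- A signed letter (b , k) on n symbols: value +(toℕ k + 1) if b = true,
-- value -(toℕ k + 1) if b = false.
Letter : ℕ → Set
Letter n = Bool × Fin n

-- A signed permutation on n symbols, as its word σ(1)⋯σ(n): the absolute
-- values are pairwise distinct (hence a permutation of 1..n).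
IsSignedPerm : ∀ {n} → Vec (Letter n) n → Set
IsSignedPerm v = AllPairs _≢_ (map proj₂ (toList v))

isSignedPerm? : ∀ {n} → Decidable (IsSignedPerm {n})
isSignedPerm? v = allPairs? (λ x y → ¬? (x ≟ y)) (map proj₂ (toList v))

-- position in the order 1 < 2 < ⋯ < n < -n < ⋯ < -2 < -1
rank : ∀ {n} → Letter n → ℕ
rank {n} (true  , k) = toℕ k
rank {n} (false , k) = (2 ℕ.* n ∸ 1) ∸ toℕ k

-- number of descents: positions i < n with σ(i) > σ(i+1), plus position n if σ(n) < 0
desList : ∀ {n} → List (Letter n) → ℕ
desList [] = 0
desList ((true , _) ∷ []) = 0
desList ((false , _) ∷ []) = 1
desList (x ∷ y ∷ xs) = (if ⌊ rank y <? rank x ⌋ then 1 else 0) ℕ.+ desList (y ∷ xs)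

des : ∀ {n} → Vec (Letter n) n → ℕ
des v = desList (toList v)

words : ∀ {A : Set} (m : ℕ) → List A → List (Vec A m)
words zero xs = []ᵥ ∷ []
words (suc m) xs = concatMap (λ x → map (x ∷ᵥ_) (words m xs)) xs

letters : (n : ℕ) → List (Letter n)
letters n = cartesianProduct (true ∷ false ∷ []) (allFin n)

signedPerms : (n : ℕ) → List (Vec (Letter n) n)
signedPerms n = filter isSignedPerm? (words n (letters n))

signedEulerian : (n k : ℕ) → ℕ
signedEulerian n k = length (filter (λ v → des v ℕ.≟ k) (signedPerms n))

-- Write w^n_j[i] = Σ_{r ≤ i} (-1)^r C(n+1,r) f(r) with f(r) = (2i - 2r + 1)^(n-j).
--
-- Pascal's rule C(n+2,r+1) = C(n+1,r) + C(n+1,r+1) splits the sum defining w^{n+1}_{j+1}[i+1] into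
-- w^n_j[i+1] - w^n_j[i], since shifting r by one turns the base 2(i+1) - 2(r+1) + 1 into 2i - 2r + 1.
--
-- For i = n, the full sum Σ_{r ≤ n+1} (-1)^r C(n+1,r) f(r) is, up to sign, the (n+1)-st forward
-- difference of f, a polynomial of degree n - j ≤ n; so it vanishes, and w^n_j[n] is minus the term
-- r = n+1, that is -(-1)^(n+1) (-1)^(n-j) = (-1)^j.
--
-- For j = 0, w^n_0[k] and the signed Eulerian numbers B(n,k) are both 1 at k = 0 and at k = n, and both
-- satisfy B(n+1,k+1) = (2k+3) B(n,k+1) + (2(n-k)+1) B(n,k) for k < n. For w the recurrence holds
-- termwise, by Pascal's rule and the absorption identity (r+1) C(m,r+1) = (m-r) C(m,r). For signed
-- permutations: every signed permutation of n+1 symbols arises exactly once by inserting +1 or -1 into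
-- one of the n+1 gaps of a signed permutation u of the shifted symbols 2, ..., n+1. The inserted letter
-- forms exactly one descent with its neighbours, replacing the descent of u at that gap if there was
-- one; hence of the 2(n+1) insertions, 2 des(u) + 1 keep the number of descents and the other
-- 2(n - des(u)) + 1 raise it by one.

module Submission where

open import Defs

module Binomial where

  open import Data.Nat using (zero; suc; _+_; _*_)
  import Data.Nat.Properties as ℕP
  open import Data.Nat.Combinatorics using (_C_; nCk+nC[k+1]≡[n+1]C[k+1]; nC1≡n)
  open import Data.Nat.Tactic.RingSolver using (solve-∀)
  open import Relation.Binary.PropositionalEquality using (_≡_; refl; cong; cong₂; module ≡-Reasoning)

  open ≡-Reasoning

  C-absorption : ∀ m k → suc k * (m C suc k) + k * (m C k) ≡ m * (m C k)
  C-absorption zero    zero    = refl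
  C-absorption zero    (suc k) = cong₂ _+_ (ℕP.*-zeroʳ (suc (suc k))) (ℕP.*-zeroʳ (suc k))
  C-absorption (suc m) zero    = begin
    1 * (suc m C 1) + 0  ≡⟨ ℕP.+-identityʳ _ ⟩
    1 * (suc m C 1)      ≡⟨ ℕP.*-identityˡ _ ⟩
    suc m C 1            ≡⟨ nC1≡n (suc m) ⟩
    suc m                ≡⟨ ℕP.*-identityʳ (suc m) ⟨
    suc m * 1            ∎
  C-absorption (suc m) (suc k) = begin
    (2 + k) * (suc m C suc (suc k)) + suc k * (suc m C suc k)
      ≡⟨ cong₂ (λ x y → (2 + k) * x + suc k * y) (pascal (suc k)) (pascal k) ⟨
    (2 + k) * (b + c) + suc k * (a + b)
      ≡⟨ regroup k a b c ⟩
    ((2 + k) * c + suc k * b) + (suc k * b + k * a) + (a + b)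
      ≡⟨ cong₂ (λ x y → x + y + (a + b)) (C-absorption m (suc k)) (C-absorption m k) ⟩
    m * b + m * a + (a + b)
      ≡⟨ collect m a b ⟩
    suc m * (a + b)
      ≡⟨ cong (suc m *_) (pascal k) ⟩
    suc m * (suc m C suc k) ∎
    where
    pascal = nCk+nC[k+1]≡[n+1]C[k+1] m
    a = m C k
    b = m C suc k
    c = m C suc (suc k)
    regroup : ∀ k a b c → (2 + k) * (b + c) + suc k * (a + b)
                        ≡ ((2 + k) * c + suc k * b) + (suc k * b + k * a) + (a + b)
    regroup = solve-∀
    collect : ∀ m a b → m * b + m * a + (a + b) ≡ suc m * (a + b)
    collect = solve-∀

module AlternatingSums where

  open import Data.Nat as ℕ using (ℕ; zero; suc; _≤_; _<_; _∸_; s≤s)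
  import Data.Nat.Properties as ℕP
  open import Data.Nat.Combinatorics using (_C_; nCk+nC[k+1]≡[n+1]C[k+1]; nCn≡1)
  open import Data.Nat.Combinatorics.Specification using (k>n⇒nCk≡0)
  open import Data.Integer using (ℤ; +_; -_; _-_; _^_; _+_; _*_; -1ℤ)
  import Data.Integer.Properties as ℤP
  open import Data.Integer.Tactic.RingSolver using (solve-∀)
  open Binomial using (C-absorption)
  open import Data.Fin using (Fin; toℕ)
  import Data.Fin.Properties as FinP
  open import Data.List using (map; foldr; applyUpTo)
  open import Function using (_∘_; id)
  open import Relation.Binary.PropositionalEquality
    using (_≡_; refl; sym; trans; cong; cong₂; module ≡-Reasoning)
  open import Algebra.Properties.Semiring.Sum ℤP.+-*-semiring
    using (sum; sum-cong-≗; ∑-distrib-+; *-distribˡ-sum)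

  open ≡-Reasoning

  pos-∸ : ∀ {m n} → n ≤ m → + (m ∸ n) ≡ + m - + n
  pos-∸ {m} {n} n≤m = trans (sym (ℤP.⊖-≥ n≤m)) (sym (ℤP.m-n≡m⊖n m n))

  pos-^ : ∀ m e → + (m ℕ.^ e) ≡ (+ m) ^ e
  pos-^ m zero    = refl
  pos-^ m (suc e) = trans (ℤP.pos-* m (m ℕ.^ e)) (cong (+ m *_) (pos-^ m e))

  pos-2*+1 : ∀ a → + (2 ℕ.* a ℕ.+ 1) ≡ + 2 * + a + + 1
  pos-2*+1 a = trans (ℤP.pos-+ (2 ℕ.* a) 1) (cong (_+ + 1) (ℤP.pos-* 2 a))

  pos-pascal : ∀ m r → + (suc m C suc r) ≡ + (m C r) + + (m C suc r)
  pos-pascal m r = trans (cong +_ (sym (nCk+nC[k+1]≡[n+1]C[k+1] m r))) (ℤP.pos-+ (m C r) _)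

  -1^-square : ∀ e → -1ℤ ^ e * -1ℤ ^ e ≡ + 1
  -1^-square zero    = refl
  -1^-square (suc e) = trans (signs-cancel (-1ℤ ^ e)) (-1^-square e)
    where
    signs-cancel : ∀ x → (-1ℤ * x) * (-1ℤ * x) ≡ x * x
    signs-cancel = solve-∀

  ∑≤ : ℕ → (ℕ → ℤ) → ℤ
  ∑≤ i f = sum (λ (r : Fin (suc i)) → f (toℕ r))

  foldr-applyUpTo≡∑ : ∀ n (g : ℕ → ℕ) (f : ℕ → ℤ) →
                      foldr _+_ (+ 0) (map f (applyUpTo g n)) ≡ sum (λ (r : Fin n) → f (g (toℕ r)))
  foldr-applyUpTo≡∑ zero    g f = refl
  foldr-applyUpTo≡∑ (suc n) g f = cong (_+_ (f (g 0))) (foldr-applyUpTo≡∑ n (g ∘ suc) f)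

  sumTo≡∑ : ∀ i f → sumTo i f ≡ ∑≤ i f
  sumTo≡∑ i = foldr-applyUpTo≡∑ (suc i) id

  sumTo-suc : ∀ i f → sumTo (suc i) f ≡ f 0 + sumTo i (f ∘ suc)
  sumTo-suc i f = trans (sumTo≡∑ (suc i) f) (cong (_+_ (f 0)) (sym (sumTo≡∑ i (f ∘ suc))))

  sumTo-last : ∀ i f → sumTo (suc i) f ≡ sumTo i f + f (suc i)
  sumTo-last zero    f = shuffle (f 0) (f 1)
    where
    shuffle : ∀ a b → a + (b + + 0) ≡ (a + + 0) + b
    shuffle = solve-∀
  sumTo-last (suc i) f = begin
    sumTo (suc (suc i)) f              ≡⟨ sumTo-suc (suc i) f ⟩
    f 0 + sumTo (suc i) (f ∘ suc)      ≡⟨ cong (_+_ (f 0)) (sumTo-last i (f ∘ suc)) ⟩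
    f 0 + (sumTo i (f ∘ suc) + f (suc (suc i))) ≡⟨ sym (ℤP.+-assoc (f 0) _ _) ⟩
    (f 0 + sumTo i (f ∘ suc)) + f (suc (suc i)) ≡⟨ cong (_+ f (suc (suc i))) (sym (sumTo-suc i f)) ⟩
    sumTo (suc i) f + f (suc (suc i))  ∎

  sumTo-cong : ∀ i {f g : ℕ → ℤ} → (∀ r → r ≤ i → f r ≡ g r) → sumTo i f ≡ sumTo i g
  sumTo-cong i {f} {g} f≗g = begin
    sumTo i f  ≡⟨ sumTo≡∑ i f ⟩
    ∑≤ i f     ≡⟨ sum-cong-≗ (λ r → f≗g (toℕ r) (FinP.toℕ≤pred[n] r)) ⟩
    ∑≤ i g     ≡⟨ sumTo≡∑ i g ⟨
    sumTo i g  ∎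

  sumTo-+ : ∀ i f g → sumTo i (λ r → f r + g r) ≡ sumTo i f + sumTo i g
  sumTo-+ i f g = begin
    sumTo i (λ r → f r + g r)  ≡⟨ sumTo≡∑ i (λ r → f r + g r) ⟩
    ∑≤ i (λ r → f r + g r)     ≡⟨ ∑-distrib-+ {suc i} (f ∘ toℕ) (g ∘ toℕ) ⟩
    ∑≤ i f + ∑≤ i g            ≡⟨ cong₂ _+_ (sumTo≡∑ i f) (sumTo≡∑ i g) ⟨
    sumTo i f + sumTo i g      ∎

  sumTo-* : ∀ i c f → sumTo i (λ r → c * f r) ≡ c * sumTo i f
  sumTo-* i c f = begin
    sumTo i (λ r → c * f r)  ≡⟨ sumTo≡∑ i (λ r → c * f r) ⟩
    ∑≤ i (λ r → c * f r)    ≡⟨ *-distribˡ-sum {suc i} c (f ∘ toℕ) ⟨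
    c * ∑≤ i f               ≡⟨ cong (c *_) (sumTo≡∑ i f) ⟨
    c * sumTo i f            ∎

  sumTo-- : ∀ i f g → sumTo i (λ r → f r - g r) ≡ sumTo i f - sumTo i g
  sumTo-- i f g = begin
    sumTo i (λ r → f r - g r)
      ≡⟨ sumTo-cong i (λ r _ → cong (_+_ (f r)) (sym (ℤP.-1*i≡-i (g r)))) ⟩
    sumTo i (λ r → f r + -1ℤ * g r)
      ≡⟨ sumTo-+ i f _ ⟩
    sumTo i f + sumTo i (λ r → -1ℤ * g r)
      ≡⟨ cong (_+_ (sumTo i f)) (trans (sumTo-* i -1ℤ g) (ℤP.-1*i≡-i _)) ⟩
    sumTo i f - sumTo i g ∎

  -- By definition, w n j i = alt (suc n) (λ r → + ((2 * i ∸ 2 * r + 1) ^ (n ∸ j))) i.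
  alt : ℕ → (ℕ → ℤ) → ℕ → ℤ
  alt m f i = sumTo i (λ r → -1ℤ ^ r * + (m C r) * f r)

  alt-cong : ∀ m i {f g} → (∀ r → r ≤ i → f r ≡ g r) → alt m f i ≡ alt m g i
  alt-cong m i f≗g = sumTo-cong i (λ r r≤i → cong (-1ℤ ^ r * + (m C r) *_) (f≗g r r≤i))

  alt-last : ∀ m f i → alt m f (suc i) ≡ alt m f i + -1ℤ ^ suc i * + (m C suc i) * f (suc i)
  alt-last m f i = sumTo-last i (λ r → -1ℤ ^ r * + (m C r) * f r)

  alt-pascal : ∀ m f i → alt (suc m) f (suc i) ≡ alt m f (suc i) - alt m (f ∘ suc) i
  alt-pascal m f i = begin
    alt (suc m) f (suc i)
      ≡⟨ sumTo-suc i T ⟩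
    G 0 + sumTo i (λ r → T (suc r))
      ≡⟨ cong (_+_ (G 0)) (sumTo-cong i (λ r _ → pascal-term r)) ⟩
    G 0 + sumTo i (λ r → G (suc r) - H r)
      ≡⟨ cong (_+_ (G 0)) (sumTo-- i (G ∘ suc) H) ⟩
    G 0 + (sumTo i (G ∘ suc) - sumTo i H)
      ≡⟨ ℤP.+-assoc (G 0) _ _ ⟨
    (G 0 + sumTo i (G ∘ suc)) - sumTo i H
      ≡⟨ cong (_- sumTo i H) (sumTo-suc i G) ⟨
    alt m f (suc i) - alt m (f ∘ suc) i ∎
    where
    T G H : ℕ → ℤ
    T r = -1ℤ ^ r * + (suc m C r) * f r
    G r = -1ℤ ^ r * + (m C r) * f r
    H r = -1ℤ ^ r * + (m C r) * f (suc r)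
    distribute : ∀ x a b y → (-1ℤ * x) * (a + b) * y ≡ (-1ℤ * x) * b * y - x * a * y
    distribute = solve-∀
    pascal-term : ∀ r → T (suc r) ≡ G (suc r) - H r
    pascal-term r = begin
      T (suc r)
        ≡⟨ cong (λ c → -1ℤ ^ suc r * c * f (suc r)) (pos-pascal m r) ⟩
      -1ℤ ^ suc r * (+ (m C r) + + (m C suc r)) * f (suc r)
        ≡⟨ distribute (-1ℤ ^ r) _ _ _ ⟩
      G (suc r) - H r ∎

  odd-gap-suc : ∀ i r → 2 ℕ.* suc i ∸ 2 ℕ.* suc r ≡ 2 ℕ.* i ∸ 2 ℕ.* r
  odd-gap-suc i r = cong₂ _∸_ (ℕP.*-suc 2 i) (ℕP.*-suc 2 r)

  w-pascal : ∀ n j i → w (suc n) (suc j) (suc i) ≡ w n j (suc i) - w n j i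
  w-pascal n j i = trans (alt-pascal (suc n) f i) (cong (_-_ (w n j (suc i))) (alt-cong (suc n) i shift))
    where
    f : ℕ → ℤ
    f r = + ((2 ℕ.* suc i ∸ 2 ℕ.* r ℕ.+ 1) ℕ.^ (n ∸ j))
    shift : ∀ r → r ≤ i → f (suc r) ≡ + ((2 ℕ.* i ∸ 2 ℕ.* r ℕ.+ 1) ℕ.^ (n ∸ j))
    shift r _ = cong (λ x → + ((x ℕ.+ 1) ℕ.^ (n ∸ j))) (odd-gap-suc i r)

  Δ : (ℕ → ℤ) → ℕ → ℤ
  Δ f r = f (suc r) - f r

  -- f is a polynomial of degree at most d: its d-th forward difference is constant.
  Degree≤ : ℕ → (ℕ → ℤ) → Set
  Degree≤ zero    f = ∀ r → f (suc r) ≡ f r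
  Degree≤ (suc d) f = Degree≤ d (Δ f)

  Degree≤-cong : ∀ d {f g} → (∀ r → f r ≡ g r) → Degree≤ d f → Degree≤ d g
  Degree≤-cong zero    f≗g const r = trans (sym (f≗g (suc r))) (trans (const r) (f≗g r))
  Degree≤-cong (suc d) f≗g deg = Degree≤-cong d (λ r → cong₂ _-_ (f≗g (suc r)) (f≗g r)) deg

  Degree≤-+ : ∀ d f g → Degree≤ d f → Degree≤ d g → Degree≤ d (λ r → f r + g r)
  Degree≤-+ zero    f g df dg r = cong₂ _+_ (df r) (dg r)
  Degree≤-+ (suc d) f g df dg =
    Degree≤-cong d (λ r → Δ-+ (f (suc r)) (f r) (g (suc r)) (g r)) (Degree≤-+ d (Δ f) (Δ g) df dg)
    where
    Δ-+ : ∀ a b c e → (a - b) + (c - e) ≡ (a + c) - (b + e)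
    Δ-+ = solve-∀

  Degree≤-* : ∀ d c f → Degree≤ d f → Degree≤ d (λ r → c * f r)
  Degree≤-* zero    c f df r = cong (c *_) (df r)
  Degree≤-* (suc d) c f df =
    Degree≤-cong d (λ r → Δ-* c (f (suc r)) (f r)) (Degree≤-* d c (Δ f) df)
    where
    Δ-* : ∀ c a b → c * (a - b) ≡ c * a - c * b
    Δ-* = solve-∀

  Degree≤-shift : ∀ d f → Degree≤ d f → Degree≤ d (f ∘ suc)
  Degree≤-shift zero    f df r = df (suc r)
  Degree≤-shift (suc d) f df = Degree≤-shift d (Δ f) df

  Degree≤-*-linear : ∀ d a b f → Degree≤ d f → Degree≤ (suc d) (λ r → (a + b * + r) * f r)
  Degree≤-*-linear d a b f df =
    Degree≤-cong d (λ r → sym (Δ-*-linear a b (f r) (f (suc r)) (+ r))) (difference-degree d f df)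
    where
    ℓ : ℕ → ℤ
    ℓ r = a + b * + r
    Δ-*-linear : ∀ a b x y t → (a + b * (+ 1 + t)) * y - (a + b * t) * x ≡ (a + b * t) * (y - x) + b * y
    Δ-*-linear = solve-∀
    difference-degree : ∀ d f → Degree≤ d f → Degree≤ d (λ r → ℓ r * Δ f r + b * f (suc r))
    difference-degree zero    f const r = trans (flat (suc r)) (trans (cong (b *_) (const (suc r))) (sym (flat r)))
      where
      cancel : ∀ c x y → c * (x - x) + y ≡ y
      cancel = solve-∀
      flat : ∀ r → ℓ r * Δ f r + b * f (suc r) ≡ b * f (suc r)
      flat r = trans (cong (λ x → ℓ r * (x - f r) + b * f (suc r)) (const r)) (cancel (ℓ r) (f r) _)
    difference-degree (suc d) f df =
      Degree≤-+ (suc d) (λ r → ℓ r * Δ f r) (λ r → b * f (suc r))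
        (Degree≤-*-linear d a b (Δ f) df)
        (Degree≤-* (suc d) b (f ∘ suc) (Degree≤-shift (suc d) f df))

  Degree≤-pow-linear : ∀ a b e → Degree≤ e (λ r → (a + b * + r) ^ e)
  Degree≤-pow-linear a b zero    r = refl
  Degree≤-pow-linear a b (suc e) = Degree≤-*-linear e a b _ (Degree≤-pow-linear a b e)

  alt-Δ : ∀ m f i → alt m (Δ f) i ≡ alt m (f ∘ suc) i - alt m f i
  alt-Δ m f i = trans (sumTo-cong i (λ r _ → distrib (c r) (f (suc r)) (f r)))
                      (sumTo-- i (λ r → c r * f (suc r)) (λ r → c r * f r))
    where
    c : ℕ → ℤ
    c r = -1ℤ ^ r * + (m C r)
    distrib : ∀ c a b → c * (a - b) ≡ c * a - c * b
    distrib = solve-∀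

  alt-beyond : ∀ m f → alt m f (suc m) ≡ alt m f m
  alt-beyond m f = begin
    alt m f (suc m)
      ≡⟨ alt-last m f m ⟩
    alt m f m + -1ℤ ^ suc m * + (m C suc m) * f (suc m)
      ≡⟨ cong (λ c → alt m f m + -1ℤ ^ suc m * + c * f (suc m)) (k>n⇒nCk≡0 (ℕP.n<1+n m)) ⟩
    alt m f m + -1ℤ ^ suc m * + 0 * f (suc m)
      ≡⟨ vanish (alt m f m) (-1ℤ ^ suc m) (f (suc m)) ⟩
    alt m f m ∎
    where
    vanish : ∀ a s y → a + s * + 0 * y ≡ a
    vanish = solve-∀

  alt-top-suc : ∀ m f → alt (suc m) f (suc m) ≡ - alt m (Δ f) m
  alt-top-suc m f = begin
    alt (suc m) f (suc m)                 ≡⟨ alt-pascal m f m ⟩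
    alt m f (suc m) - alt m (f ∘ suc) m   ≡⟨ cong (_- alt m (f ∘ suc) m) (alt-beyond m f) ⟩
    alt m f m - alt m (f ∘ suc) m         ≡⟨ swap (alt m f m) (alt m (f ∘ suc) m) ⟩
    - (alt m (f ∘ suc) m - alt m f m)     ≡⟨ cong -_ (alt-Δ m f m) ⟨
    - alt m (Δ f) m                       ∎
    where
    swap : ∀ a b → a - b ≡ - (b - a)
    swap = solve-∀

  alt-vanish : ∀ m d f → Degree≤ d f → d < m → alt m f m ≡ + 0
  alt-vanish (suc m) zero    f const _ = begin
    alt (suc m) f (suc m)              ≡⟨ alt-top-suc m f ⟩
    - alt m (Δ f) m                    ≡⟨ cong -_ (alt-Δ m f m) ⟩
    - (alt m (f ∘ suc) m - alt m f m)  ≡⟨ cong (λ x → - (x - alt m f m)) (alt-cong m m (λ r _ → const r)) ⟩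
    - (alt m f m - alt m f m)          ≡⟨ cong -_ (ℤP.+-inverseʳ (alt m f m)) ⟩
    + 0                                ∎
  alt-vanish (suc m) (suc d) f deg (s≤s d<m) =
    trans (alt-top-suc m f) (cong -_ (alt-vanish m d (Δ f) deg d<m))

  -- The truncated subtraction in the definition of w is exact in the range r ≤ i of the sum.
  odd-gap : ∀ {i r} → r ≤ i → + (2 ℕ.* i ∸ 2 ℕ.* r ℕ.+ 1) ≡ + 2 * + i + + 1 + - + 2 * + r
  odd-gap {i} {r} r≤i = begin
    + (2 ℕ.* i ∸ 2 ℕ.* r ℕ.+ 1)        ≡⟨ ℤP.pos-+ (2 ℕ.* i ∸ 2 ℕ.* r) 1 ⟩
    + (2 ℕ.* i ∸ 2 ℕ.* r) + + 1        ≡⟨ cong (_+ + 1) (pos-∸ (ℕP.*-monoʳ-≤ 2 r≤i)) ⟩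
    (+ (2 ℕ.* i) - + (2 ℕ.* r)) + + 1  ≡⟨ cong₂ (λ a b → a - b + + 1) (ℤP.pos-* 2 i) (ℤP.pos-* 2 r) ⟩
    (+ 2 * + i - + 2 * + r) + + 1      ≡⟨ regroup (+ i) (+ r) ⟩
    + 2 * + i + + 1 + - + 2 * + r      ∎
    where
    regroup : ∀ x y → (+ 2 * x - + 2 * y) + + 1 ≡ + 2 * x + + 1 + - + 2 * y
    regroup = solve-∀

  w-top : ∀ n j → j ≤ n → w n j n ≡ -1ℤ ^ j
  w-top n j j≤n = begin
    w n j n
      ≡⟨ alt-cong (suc n) n (λ r r≤n → trans (pos-^ _ e) (cong (_^ e) (odd-gap r≤n))) ⟩
    alt (suc n) p n
      ≡⟨ x+t≡0⇒x≡-t top-vanishes ⟩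
    - (-1ℤ ^ suc n * + (suc n C suc n) * p (suc n))
      ≡⟨ cong₂ (λ c x → - (-1ℤ ^ suc n * + c * x ^ e)) (nCn≡1 (suc n)) last-base ⟩
    - (-1ℤ ^ suc n * + 1 * -1ℤ ^ e)
      ≡⟨ cong (λ k → - (-1ℤ ^ suc k * + 1 * -1ℤ ^ e)) (ℕP.m+[n∸m]≡n j≤n) ⟨
    - (-1ℤ * -1ℤ ^ (j ℕ.+ e) * + 1 * -1ℤ ^ e)
      ≡⟨ cong (λ x → - (-1ℤ * x * + 1 * -1ℤ ^ e)) (ℤP.^-distribˡ-+-* -1ℤ j e) ⟩
    - (-1ℤ * (-1ℤ ^ j * -1ℤ ^ e) * + 1 * -1ℤ ^ e)
      ≡⟨ regroup (-1ℤ ^ j) (-1ℤ ^ e) ⟩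
    -1ℤ ^ j * (-1ℤ ^ e * -1ℤ ^ e)
      ≡⟨ cong (-1ℤ ^ j *_) (-1^-square e) ⟩
    -1ℤ ^ j * + 1
      ≡⟨ ℤP.*-identityʳ (-1ℤ ^ j) ⟩
    -1ℤ ^ j ∎
    where
    e = n ∸ j
    p : ℕ → ℤ
    p r = (+ 2 * + n + + 1 + - + 2 * + r) ^ e
    top-vanishes : alt (suc n) p n + -1ℤ ^ suc n * + (suc n C suc n) * p (suc n) ≡ + 0
    top-vanishes = trans (sym (alt-last (suc n) p n))
      (alt-vanish (suc n) e p (Degree≤-pow-linear (+ 2 * + n + + 1) (- + 2) e) (s≤s (ℕP.m∸n≤m n j)))
    last-base : + 2 * + n + + 1 + - + 2 * + suc n ≡ -1ℤ
    last-base = trans (cong (λ x → + 2 * + n + + 1 + - + 2 * x) (ℤP.pos-+ 1 n)) (value (+ n))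
      where
      value : ∀ x → + 2 * x + + 1 + - + 2 * (+ 1 + x) ≡ -1ℤ
      value = solve-∀
    x+t≡0⇒x≡-t : ∀ {x t} → x + t ≡ + 0 → x ≡ - t
    x+t≡0⇒x≡-t {x} {t} x+t≡0 = trans (cancel x t) (trans (cong (_- t) x+t≡0) (ℤP.+-identityˡ (- t)))
      where
      cancel : ∀ x t → x ≡ (x + t) - t
      cancel = solve-∀
    regroup : ∀ a b → - (-1ℤ * (a * b) * + 1 * b) ≡ a * (b * b)
    regroup = solve-∀

  w-zero-zero : ∀ n → w n 0 0 ≡ + 1
  w-zero-zero n = cong (λ x → + 1 * + 1 * + x + + 0) (ℕP.^-zeroˡ n)

  -- The (ρ+1)-st term of the recurrence for w, with S = (-1)^ρ, C₀ = C(n+1,ρ), C₁ = C(n+1,ρ+1) and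
  -- P = (2k - 2ρ + 1)^n.
  recurrence-identity : ∀ S C₀ C₁ P R k n → (+ 1 + R) * C₁ + R * C₀ ≡ (+ 1 + n) * C₀ →
    (-1ℤ * S) * (C₀ + C₁) * ((+ 2 * k + + 1 + - + 2 * R) * P)
      ≡ (+ 2 * (+ 1 + k) + + 1) * ((-1ℤ * S) * C₁ * P) + (+ 2 * (n - k) + + 1) * (S * C₀ * P)
  recurrence-identity S C₀ C₁ P R k n absorb = begin
    (-1ℤ * S) * (C₀ + C₁) * ((+ 2 * k + + 1 + - + 2 * R) * P)
      ≡⟨ expand S C₀ C₁ P R k n ⟩
    rhs + (+ 2 * S * P) * (((+ 1 + R) * C₁ + R * C₀) - (+ 1 + n) * C₀)
      ≡⟨ cong (λ x → rhs + (+ 2 * S * P) * (x - (+ 1 + n) * C₀)) absorb ⟩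
    rhs + (+ 2 * S * P) * ((+ 1 + n) * C₀ - (+ 1 + n) * C₀)
      ≡⟨ cancel rhs (+ 2 * S * P) ((+ 1 + n) * C₀) ⟩
    rhs ∎
    where
    rhs = (+ 2 * (+ 1 + k) + + 1) * ((-1ℤ * S) * C₁ * P) + (+ 2 * (n - k) + + 1) * (S * C₀ * P)
    expand : ∀ S C₀ C₁ P R k n →
      (-1ℤ * S) * (C₀ + C₁) * ((+ 2 * k + + 1 + - + 2 * R) * P)
        ≡ ((+ 2 * (+ 1 + k) + + 1) * ((-1ℤ * S) * C₁ * P) + (+ 2 * (n - k) + + 1) * (S * C₀ * P))
          + (+ 2 * S * P) * (((+ 1 + R) * C₁ + R * C₀) - (+ 1 + n) * C₀)
    expand = solve-∀
    cancel : ∀ a b x → a + b * (x - x) ≡ a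
    cancel = solve-∀

  w-zero-suc : ∀ n k → k ≤ n →
    w (suc n) 0 (suc k) ≡ + (2 ℕ.* suc k ℕ.+ 1) * w n 0 (suc k) + + (2 ℕ.* (n ∸ k) ℕ.+ 1) * w n 0 k
  w-zero-suc n k k≤n = begin
    alt (suc (suc n)) f (suc k)
      ≡⟨ sumTo-suc k t ⟩
    t 0 + sumTo k (t ∘ suc)
      ≡⟨ cong₂ _+_ first-term (sumTo-cong k (λ ρ ρ≤k → later-term ρ ρ≤k)) ⟩
    K * G 0 + sumTo k (λ ρ → K * G (suc ρ) + M * H ρ)
      ≡⟨ cong (_+_ (K * G 0)) (sumTo-+ k (λ ρ → K * G (suc ρ)) (λ ρ → M * H ρ)) ⟩
    K * G 0 + (sumTo k (λ ρ → K * G (suc ρ)) + sumTo k (λ ρ → M * H ρ))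
      ≡⟨ cong (_+_ (K * G 0)) (cong₂ _+_ (sumTo-* k K (G ∘ suc)) (sumTo-* k M H)) ⟩
    K * G 0 + (K * sumTo k (G ∘ suc) + M * sumTo k H)
      ≡⟨ factor K (G 0) (sumTo k (G ∘ suc)) (M * sumTo k H) ⟩
    K * (G 0 + sumTo k (G ∘ suc)) + M * sumTo k H
      ≡⟨ cong (λ x → K * x + M * sumTo k H) (sumTo-suc k G) ⟨
    K * w n 0 (suc k) + M * w n 0 k ∎
    where
    K M : ℤ
    K = + (2 ℕ.* suc k ℕ.+ 1)
    M = + (2 ℕ.* (n ∸ k) ℕ.+ 1)
    f g h : ℕ → ℤ
    f r = + ((2 ℕ.* suc k ∸ 2 ℕ.* r ℕ.+ 1) ℕ.^ suc n)
    g r = + ((2 ℕ.* suc k ∸ 2 ℕ.* r ℕ.+ 1) ℕ.^ n)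
    h r = + ((2 ℕ.* k ∸ 2 ℕ.* r ℕ.+ 1) ℕ.^ n)
    t G H : ℕ → ℤ
    t r = -1ℤ ^ r * + (suc (suc n) C r) * f r
    G r = -1ℤ ^ r * + (suc n C r) * g r
    H r = -1ℤ ^ r * + (suc n C r) * h r
    factor : ∀ k a b c → k * a + (k * b + c) ≡ k * (a + b) + c
    factor = solve-∀
    first-term : t 0 ≡ K * G 0
    first-term = trans (cong (+ 1 * + 1 *_) (ℤP.pos-* (2 ℕ.* suc k ℕ.+ 1) _)) (reassoc K (g 0))
      where
      reassoc : ∀ k x → + 1 * + 1 * (k * x) ≡ k * (+ 1 * + 1 * x)
      reassoc = solve-∀
    later-term : ∀ ρ → ρ ≤ k → t (suc ρ) ≡ K * G (suc ρ) + M * H ρ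
    later-term ρ ρ≤k = begin
      -1ℤ ^ suc ρ * + (suc (suc n) C suc ρ) * f (suc ρ)
        ≡⟨ cong₂ (λ c x → -1ℤ ^ suc ρ * c * x) (pos-pascal (suc n) ρ) power ⟩
      (-1ℤ * S) * (C₀ + C₁) * ((+ 2 * + k + + 1 + - + 2 * + ρ) * h ρ)
        ≡⟨ recurrence-identity S C₀ C₁ (h ρ) (+ ρ) (+ k) (+ n) absorb ⟩
      (+ 2 * (+ 1 + + k) + + 1) * ((-1ℤ * S) * C₁ * h ρ) + (+ 2 * (+ n - + k) + + 1) * (S * C₀ * h ρ)
        ≡⟨ cong₂ _+_ (cong₂ (λ a x → a * (-1ℤ * S * C₁ * x)) K≡ (shift ρ)) (cong (_* H ρ) M≡) ⟨
      K * G (suc ρ) + M * H ρ ∎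
      where
      S = -1ℤ ^ ρ
      C₀ = + (suc n C ρ)
      C₁ = + (suc n C suc ρ)
      K≡ : K ≡ + 2 * (+ 1 + + k) + + 1
      K≡ = trans (pos-2*+1 (suc k)) (cong (λ x → + 2 * x + + 1) (ℤP.pos-+ 1 k))
      M≡ : M ≡ + 2 * (+ n - + k) + + 1
      M≡ = trans (pos-2*+1 (n ∸ k)) (cong (λ x → + 2 * x + + 1) (pos-∸ k≤n))
      shift : ∀ ρ → g (suc ρ) ≡ h ρ
      shift ρ = cong (λ x → + ((x ℕ.+ 1) ℕ.^ n)) (odd-gap-suc k ρ)
      power : f (suc ρ) ≡ (+ 2 * + k + + 1 + - + 2 * + ρ) * h ρ
      power = begin
        + ((2 ℕ.* suc k ∸ 2 ℕ.* suc ρ ℕ.+ 1) ℕ.^ suc n)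
          ≡⟨ cong (λ x → + ((x ℕ.+ 1) ℕ.^ suc n)) (odd-gap-suc k ρ) ⟩
        + ((2 ℕ.* k ∸ 2 ℕ.* ρ ℕ.+ 1) ℕ.^ suc n)
          ≡⟨ ℤP.pos-* (2 ℕ.* k ∸ 2 ℕ.* ρ ℕ.+ 1) _ ⟩
        + (2 ℕ.* k ∸ 2 ℕ.* ρ ℕ.+ 1) * h ρ
          ≡⟨ cong (_* h ρ) (odd-gap ρ≤k) ⟩
        (+ 2 * + k + + 1 + - + 2 * + ρ) * h ρ ∎
      absorb : (+ 1 + + ρ) * C₁ + + ρ * C₀ ≡ (+ 1 + + n) * C₀
      absorb = begin
        + (suc ρ) * C₁ + + ρ * C₀
          ≡⟨ cong₂ _+_ (ℤP.pos-* (suc ρ) _) (ℤP.pos-* ρ _) ⟨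
        + (suc ρ ℕ.* (suc n C suc ρ)) + + (ρ ℕ.* (suc n C ρ))
          ≡⟨ ℤP.pos-+ (suc ρ ℕ.* (suc n C suc ρ)) _ ⟨
        + (suc ρ ℕ.* (suc n C suc ρ) ℕ.+ ρ ℕ.* (suc n C ρ))
          ≡⟨ cong +_ (C-absorption (suc n) ρ) ⟩
        + (suc n ℕ.* (suc n C ρ))
          ≡⟨ ℤP.pos-* (suc n) _ ⟩
        + (suc n) * C₀ ∎

module SignedPermutations where

  open import Data.Nat using (ℕ; zero; suc; _+_; _*_; _∸_; _≤_; _<_; s≤s; z≤n; _<?_; _≟_)
  import Data.Nat.Properties as ℕP
  open import Data.Nat.Tactic.RingSolver using (solve-∀)
  open import Data.Bool using (Bool; true; false; if_then_else_)
  open import Data.Fin using (Fin; toℕ) renaming (zero to fzero; suc to fsuc)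
  import Data.Fin.Properties as FinP
  open import Data.List using (List; []; _∷_; map; _++_; concatMap; filter; length; allFin; tabulate)
  open import Data.List.Relation.Unary.All using (All; []; _∷_; universal) renaming (map to All-map)
  open import Data.List.Relation.Unary.Any using (Any; here; there)
  open import Data.List.Relation.Unary.All.Properties using (All¬⇒¬Any)
  open import Data.List.Relation.Unary.AllPairs using (AllPairs; []; _∷_)
  open import Data.Vec using (Vec; toList; insertAt) renaming ([] to []ᵥ; _∷_ to _∷ᵥ_; map to mapᵥ)
  open import Data.Product using (_,_; proj₂)
  open import Data.Empty using (⊥-elim)
  open import Function using (_∘_)
  open import Relation.Unary using (Decidable)
  open import Relation.Nullary using (¬_; Dec; yes; no)
  open import Relation.Nullary.Decidable using (isYes)
  open import Relation.Binary.PropositionalEquality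
    using (_≡_; _≢_; refl; sym; trans; cong; cong₂; subst; subst₂; module ≡-Reasoning)
  open import Algebra.Properties.Semiring.Sum ℕP.+-*-semiring
    using (sum-syntax; sum-cong-≗; sum-replicate-zero; ∑-distrib-+; *-distribˡ-sum; *-distribʳ-sum)

  open import Algebra.Properties.CommutativeSemigroup ℕP.+-commutativeSemigroup
    using () renaming (interchange to +-interchange)

  open ≡-Reasoning

  ∑ₗ : {A : Set} → (A → ℕ) → List A → ℕ
  ∑ₗ f []       = 0
  ∑ₗ f (x ∷ xs) = f x + ∑ₗ f xs

  module _ {A : Set} where

    ∑ₗ-cong : ∀ {f g : A → ℕ} xs → (∀ x → f x ≡ g x) → ∑ₗ f xs ≡ ∑ₗ g xs
    ∑ₗ-cong []       f≗g = refl
    ∑ₗ-cong (x ∷ xs) f≗g = cong₂ _+_ (f≗g x) (∑ₗ-cong xs f≗g)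

    ∑ₗ-zero : ∀ (f : A → ℕ) xs → (∀ x → f x ≡ 0) → ∑ₗ f xs ≡ 0
    ∑ₗ-zero f xs f≗0 = trans (∑ₗ-cong xs f≗0) (zeros xs)
      where
      zeros : ∀ xs → ∑ₗ (λ _ → 0) xs ≡ 0
      zeros []       = refl
      zeros (_ ∷ xs) = zeros xs

    ∑ₗ-++ : ∀ (f : A → ℕ) xs ys → ∑ₗ f (xs ++ ys) ≡ ∑ₗ f xs + ∑ₗ f ys
    ∑ₗ-++ f []       ys = refl
    ∑ₗ-++ f (x ∷ xs) ys = trans (cong (f x +_) (∑ₗ-++ f xs ys)) (sym (ℕP.+-assoc (f x) _ _))

    ∑ₗ-+ : ∀ (f g : A → ℕ) xs → ∑ₗ (λ x → f x + g x) xs ≡ ∑ₗ f xs + ∑ₗ g xs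
    ∑ₗ-+ f g []       = refl
    ∑ₗ-+ f g (x ∷ xs) = trans (cong (f x + g x +_) (∑ₗ-+ f g xs)) (+-interchange (f x) (g x) _ _)

    ∑ₗ-* : ∀ c (f : A → ℕ) xs → ∑ₗ (λ x → c * f x) xs ≡ c * ∑ₗ f xs
    ∑ₗ-* c f []       = sym (ℕP.*-zeroʳ c)
    ∑ₗ-* c f (x ∷ xs) = trans (cong (c * f x +_) (∑ₗ-* c f xs)) (sym (ℕP.*-distribˡ-+ c (f x) _))

    ∑ₗ-∑-comm : ∀ {K} (h : Fin K → A → ℕ) xs →
           ∑ₗ (λ x → ∑[ p < K ] h p x) xs ≡ ∑[ p < K ] ∑ₗ (h p) xs
    ∑ₗ-∑-comm {K} h []       = sym (sum-replicate-zero K)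
    ∑ₗ-∑-comm {K} h (x ∷ xs) = trans (cong (∑[ p < K ] h p x +_) (∑ₗ-∑-comm h xs))
                                (sym (∑-distrib-+ (λ p → h p x) (λ p → ∑ₗ (h p) xs)))

    ∑ₗ-tabulate : ∀ {K} (f : A → ℕ) (g : Fin K → A) → ∑ₗ f (tabulate g) ≡ ∑[ p < K ] f (g p)
    ∑ₗ-tabulate {zero}  f g = refl
    ∑ₗ-tabulate {suc K} f g = cong (f (g fzero) +_) (∑ₗ-tabulate f (g ∘ fsuc))

  module _ {A B : Set} where

    ∑ₗ-map : ∀ (f : B → ℕ) (g : A → B) xs → ∑ₗ f (map g xs) ≡ ∑ₗ (f ∘ g) xs
    ∑ₗ-map f g []       = refl
    ∑ₗ-map f g (x ∷ xs) = cong (f (g x) +_) (∑ₗ-map f g xs)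

    ∑ₗ-concatMap : ∀ (f : B → ℕ) (g : A → List B) xs →
                   ∑ₗ f (concatMap g xs) ≡ ∑ₗ (∑ₗ f ∘ g) xs
    ∑ₗ-concatMap f g []       = refl
    ∑ₗ-concatMap f g (x ∷ xs) =
      trans (∑ₗ-++ f (g x) (concatMap g xs)) (cong (∑ₗ f (g x) +_) (∑ₗ-concatMap f g xs))

  -- A word over n letters is lifted to n + 1 letters by raising every absolute value by one,
  -- which frees the symbol 1 for the letters ±1 (+1 for true).
  lift : ∀ {n} → Letter n → Letter (suc n)
  lift (b , k) = b , fsuc k

  ±1 : ∀ {n} → Bool → Letter (suc n)
  ±1 b = b , fzero

  liftV : ∀ {n m} → Vec (Letter n) m → Vec (Letter (suc n)) m
  liftV = mapᵥ lift

  ∑ᴸ : ∀ n → (Letter n → ℕ) → ℕ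
  ∑ᴸ n g = ∑ₗ g (letters n)

  ∑ᴸ-by-sign : ∀ n g → ∑ᴸ n g ≡ ∑[ k < n ] g (true , k) + (∑[ k < n ] g (false , k) + 0)
  ∑ᴸ-by-sign n g = begin
    ∑ₗ g (map (true ,_) (allFin n) ++ (map (false ,_) (allFin n) ++ []))
      ≡⟨ ∑ₗ-++ g (map (true ,_) (allFin n)) _ ⟩
    ∑ₗ g (map (true ,_) (allFin n)) + ∑ₗ g (map (false ,_) (allFin n) ++ [])
      ≡⟨ cong (∑ₗ g (map (true ,_) (allFin n)) +_) (∑ₗ-++ g (map (false ,_) (allFin n)) []) ⟩
    ∑ₗ g (map (true ,_) (allFin n)) + (∑ₗ g (map (false ,_) (allFin n)) + 0)
      ≡⟨ cong₂ (λ a b → a + (b + 0)) (signed true) (signed false) ⟩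
    ∑[ k < n ] g (true , k) + (∑[ k < n ] g (false , k) + 0) ∎
    where
    signed : ∀ b → ∑ₗ g (map (b ,_) (allFin n)) ≡ ∑[ k < n ] g (b , k)
    signed b = trans (∑ₗ-map g (b ,_) (allFin n)) (∑ₗ-tabulate (λ k → g (b , k)) (λ k → k))

  ∑ᴸ-suc : ∀ n g → ∑ᴸ (suc n) g ≡ g (±1 true) + g (±1 false) + ∑ᴸ n (g ∘ lift)
  ∑ᴸ-suc n g = begin
    ∑ᴸ (suc n) g                   ≡⟨ ∑ᴸ-by-sign (suc n) g ⟩
    (t₀ + T) + ((f₀ + F) + 0)      ≡⟨ regroup t₀ f₀ T F ⟩
    t₀ + f₀ + (T + (F + 0))        ≡⟨ cong (t₀ + f₀ +_) (∑ᴸ-by-sign n (g ∘ lift)) ⟨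
    t₀ + f₀ + ∑ᴸ n (g ∘ lift)      ∎
    where
    t₀ = g (±1 true)
    f₀ = g (±1 false)
    T = ∑[ k < n ] g (true , fsuc k)
    F = ∑[ k < n ] g (false , fsuc k)
    regroup : ∀ a b c d → (a + c) + ((b + d) + 0) ≡ a + b + (c + (d + 0))
    regroup = solve-∀

  ∑ʷ : ∀ m n → (Vec (Letter n) m → ℕ) → ℕ
  ∑ʷ m n f = ∑ₗ f (words m (letters n))

  ∑ʷ-suc : ∀ m n f → ∑ʷ (suc m) n f ≡ ∑ᴸ n (λ x → ∑ʷ m n (λ v → f (x ∷ᵥ v)))
  ∑ʷ-suc m n f = trans (∑ₗ-concatMap f _ (letters n))
                       (∑ₗ-cong (letters n) (λ x → ∑ₗ-map f (x ∷ᵥ_) (words m (letters n))))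

  ∑ʷ-cong : ∀ m n {f g} → (∀ v → f v ≡ g v) → ∑ʷ m n f ≡ ∑ʷ m n g
  ∑ʷ-cong m n = ∑ₗ-cong (words m (letters n))

  ∑ʷ-zero : ∀ m n f → (∀ v → f v ≡ 0) → ∑ʷ m n f ≡ 0
  ∑ʷ-zero m n f = ∑ₗ-zero f (words m (letters n))

  ∑ʷ-+ : ∀ m n f g → ∑ʷ m n (λ v → f v + g v) ≡ ∑ʷ m n f + ∑ʷ m n g
  ∑ʷ-+ m n f g = ∑ₗ-+ f g (words m (letters n))

  ∑ʷ-* : ∀ m n c f → ∑ʷ m n (λ v → c * f v) ≡ c * ∑ʷ m n f
  ∑ʷ-* m n c f = ∑ₗ-* c f (words m (letters n))

  symbols : ∀ {n m} → Vec (Letter n) m → List (Fin n)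
  symbols v = map proj₂ (toList v)

  Distinct : ∀ {n m} → Vec (Letter n) m → Set
  Distinct v = AllPairs _≢_ (symbols v)

  insertOne : ∀ {n m} → Fin (suc m) → Bool → Vec (Letter n) m → Vec (Letter (suc n)) (suc m)
  insertOne p b u = insertAt (liftV u) p (±1 b)

  module _ {n : ℕ} where

    All-liftV⁻ : ∀ {m} {P : Fin (suc n) → Set} (u : Vec (Letter n) m) →
                 All P (symbols (liftV u)) → All (P ∘ fsuc) (symbols u)
    All-liftV⁻ []ᵥ       []         = []
    All-liftV⁻ (_ ∷ᵥ u) (px ∷ pxs) = px ∷ All-liftV⁻ u pxs

    All-liftV⁺ : ∀ {m} {P : Fin (suc n) → Set} (u : Vec (Letter n) m) →
                 All (P ∘ fsuc) (symbols u) → All P (symbols (liftV u))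
    All-liftV⁺ []ᵥ       []         = []
    All-liftV⁺ (_ ∷ᵥ u) (px ∷ pxs) = px ∷ All-liftV⁺ u pxs

    Distinct-liftV⁻ : ∀ {m} (u : Vec (Letter n) m) → Distinct (liftV u) → Distinct u
    Distinct-liftV⁻ []ᵥ       []         = []
    Distinct-liftV⁻ (_ ∷ᵥ u) (px ∷ pxs) =
      All-map (λ ne eq → ne (cong fsuc eq)) (All-liftV⁻ u px) ∷ Distinct-liftV⁻ u pxs

    Distinct-liftV⁺ : ∀ {m} (u : Vec (Letter n) m) → Distinct u → Distinct (liftV u)
    Distinct-liftV⁺ []ᵥ       []         = []
    Distinct-liftV⁺ (_ ∷ᵥ u) (px ∷ pxs) =
      All-liftV⁺ u (All-map (λ ne eq → ne (FinP.suc-injective eq)) px) ∷ Distinct-liftV⁺ u pxs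

    All-insertAt⁻ : ∀ {m} {P : Fin n → Set} (v : Vec (Letter n) m) p x →
                    All P (symbols (insertAt v p x)) → All P (symbols v)
    All-insertAt⁻ v         fzero    x (_ ∷ pv)  = pv
    All-insertAt⁻ (_ ∷ᵥ v) (fsuc p) x (py ∷ pv) = py ∷ All-insertAt⁻ v p x pv

    All-insertAt⁺ : ∀ {m} {P : Fin n → Set} (v : Vec (Letter n) m) p x →
                    P (proj₂ x) → All P (symbols v) → All P (symbols (insertAt v p x))
    All-insertAt⁺ v         fzero    x px pv         = px ∷ pv
    All-insertAt⁺ (_ ∷ᵥ v) (fsuc p) x px (py ∷ pv) = py ∷ All-insertAt⁺ v p x px pv

    Distinct-insertAt⁻ : ∀ {m} (v : Vec (Letter n) m) p x → Distinct (insertAt v p x) → Distinct v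
    Distinct-insertAt⁻ v         fzero    x (_ ∷ dv)  = dv
    Distinct-insertAt⁻ (_ ∷ᵥ v) (fsuc p) x (py ∷ dv) =
      All-insertAt⁻ v p x py ∷ Distinct-insertAt⁻ v p x dv

    Distinct-insertAt⁺ : ∀ {m} (v : Vec (Letter n) m) p x →
                         All (proj₂ x ≢_) (symbols v) → Distinct v → Distinct (insertAt v p x)
    Distinct-insertAt⁺ v         fzero    x fresh        dv        = fresh ∷ dv
    Distinct-insertAt⁺ (_ ∷ᵥ v) (fsuc p) x (ne ∷ fresh) (py ∷ dv) =
      All-insertAt⁺ v p x (λ eq → ne (sym eq)) py ∷ Distinct-insertAt⁺ v p x fresh dv

  Distinct-insertOne⁻ : ∀ {n m} (u : Vec (Letter n) m) p b → Distinct (insertOne p b u) → Distinct u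
  Distinct-insertOne⁻ u p b = Distinct-liftV⁻ u ∘ Distinct-insertAt⁻ (liftV u) p (±1 b)

  Distinct-insertOne⁺ : ∀ {n m} (u : Vec (Letter n) m) p b → Distinct u → Distinct (insertOne p b u)
  Distinct-insertOne⁺ u p b =
    Distinct-insertAt⁺ (liftV u) p (±1 b) (All-liftV⁺ u (universal (λ _ ()) (symbols u)))
    ∘ Distinct-liftV⁺ u

  ∑ʷ-by-first-letter : ∀ m n (f : Vec (Letter (suc n)) (suc m) → ℕ) →
    ∑ʷ (suc m) (suc n) f
      ≡ ∑ʷ m (suc n) (f ∘ (±1 true ∷ᵥ_)) + ∑ʷ m (suc n) (f ∘ (±1 false ∷ᵥ_))
        + ∑ᴸ n (λ y → ∑ʷ m (suc n) (f ∘ (lift y ∷ᵥ_)))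
  ∑ʷ-by-first-letter m n f =
    trans (∑ʷ-suc m (suc n) f) (∑ᴸ-suc n (λ x → ∑ʷ m (suc n) (f ∘ (x ∷ᵥ_))))

  ∑ʷ-avoiding-fzero : ∀ n m (f : Vec (Letter (suc n)) m → ℕ) →
    (∀ v → Any (fzero ≡_) (symbols v) → f v ≡ 0) → ∑ʷ m (suc n) f ≡ ∑ʷ m n (f ∘ liftV)
  ∑ʷ-avoiding-fzero n zero    f _        = refl
  ∑ʷ-avoiding-fzero n (suc m) f f-vanish = begin
    ∑ʷ (suc m) (suc n) f
      ≡⟨ ∑ʷ-by-first-letter m n f ⟩
    ∑ʷ m (suc n) (f ∘ (±1 true ∷ᵥ_)) + ∑ʷ m (suc n) (f ∘ (±1 false ∷ᵥ_)) + R
      ≡⟨ cong₂ (λ a b → a + b + R) (leading-fzero true) (leading-fzero false) ⟩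
    R
      ≡⟨ ∑ₗ-cong (letters n) (λ y → ∑ʷ-avoiding-fzero n m _ (λ _ hit → f-vanish _ (there hit))) ⟩
    ∑ᴸ n (λ y → ∑ʷ m n (f ∘ liftV ∘ (y ∷ᵥ_)))
      ≡⟨ ∑ʷ-suc m n (f ∘ liftV) ⟨
    ∑ʷ (suc m) n (f ∘ liftV) ∎
    where
    R = ∑ᴸ n (λ y → ∑ʷ m (suc n) (f ∘ (lift y ∷ᵥ_)))
    leading-fzero : ∀ b → ∑ʷ m (suc n) (f ∘ (±1 b ∷ᵥ_)) ≡ 0
    leading-fzero b = ∑ʷ-zero m (suc n) _ (λ v → f-vanish _ (here refl))

  ∑ᴵ ∑ᴵ′ : ∀ {n m} → (Vec (Letter (suc n)) (suc m) → ℕ) → Bool → ℕ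
  ∑ᴵ  {n} {m} f b = ∑[ p < suc m ] ∑ʷ m n (f ∘ insertOne p b)
  ∑ᴵ′ {n} {m} f b = ∑[ p < m ] ∑ʷ m n (f ∘ insertOne (fsuc p) b)

  -- A word with distinct symbols over n + 1 letters either avoids the symbol 1, or arises from a unique
  -- word over n letters by inserting ±1 at a unique position.
  mutual
    ∑ʷ-split : ∀ n m (f : Vec (Letter (suc n)) (suc m) → ℕ) → (∀ v → ¬ Distinct v → f v ≡ 0) →
      ∑ʷ (suc m) (suc n) f ≡ ∑ʷ (suc m) n (f ∘ liftV) + (∑ᴵ f true + ∑ᴵ f false)
    ∑ʷ-split n m f f-vanish = begin
      ∑ʷ (suc m) (suc n) f
        ≡⟨ ∑ʷ-by-first-letter m n f ⟩
      ∑ʷ m (suc n) (f ∘ (±1 true ∷ᵥ_)) + ∑ʷ m (suc n) (f ∘ (±1 false ∷ᵥ_)) + R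
        ≡⟨ cong₂ (λ a b → a + b + R) (leading-fzero true) (leading-fzero false) ⟩
      H true + H false + R
        ≡⟨ cong (H true + H false +_) (∑ʷ-split-tail n m f f-vanish) ⟩
      H true + H false + (L + (∑ᴵ′ f true + ∑ᴵ′ f false))
        ≡⟨ regroup (H true) (H false) L (∑ᴵ′ f true) (∑ᴵ′ f false) ⟩
      L + ((H true + ∑ᴵ′ f true) + (H false + ∑ᴵ′ f false)) ∎
      where
      R = ∑ᴸ n (λ y → ∑ʷ m (suc n) (f ∘ (lift y ∷ᵥ_)))
      L = ∑ʷ (suc m) n (f ∘ liftV)
      H : Bool → ℕ
      H b = ∑ʷ m n (f ∘ insertOne fzero b)
      leading-fzero : ∀ b → ∑ʷ m (suc n) (f ∘ (±1 b ∷ᵥ_)) ≡ H b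
      leading-fzero b =
        ∑ʷ-avoiding-fzero n m _ (λ _ hit → f-vanish _ (λ { (fresh ∷ _) → All¬⇒¬Any fresh hit }))
      regroup : ∀ a b x c d → a + b + (x + (c + d)) ≡ x + ((a + c) + (b + d))
      regroup = solve-∀

    ∑ʷ-split-tail : ∀ n m (f : Vec (Letter (suc n)) (suc m) → ℕ) → (∀ v → ¬ Distinct v → f v ≡ 0) →
      ∑ᴸ n (λ y → ∑ʷ m (suc n) (f ∘ (lift y ∷ᵥ_))) ≡ ∑ʷ (suc m) n (f ∘ liftV) + (∑ᴵ′ f true + ∑ᴵ′ f false)
    ∑ʷ-split-tail n zero    f _        = trans (sym (∑ʷ-suc 0 n (f ∘ liftV))) (sym (ℕP.+-identityʳ _))
    ∑ʷ-split-tail n (suc m) f f-vanish = begin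
      ∑ᴸ n (λ y → ∑ʷ (suc m) (suc n) (g y))
        ≡⟨ ∑ₗ-cong (letters n) (λ y → ∑ʷ-split n m (g y) (λ _ nd → f-vanish _ (λ { (_ ∷ d) → nd d }))) ⟩
      ∑ᴸ n (λ y → ∑ʷ (suc m) n (g y ∘ liftV) + (∑ᴵ (g y) true + ∑ᴵ (g y) false))
        ≡⟨ ∑ₗ-+ _ _ (letters n) ⟩
      ∑ᴸ n (λ y → ∑ʷ (suc m) n (g y ∘ liftV)) + ∑ᴸ n (λ y → ∑ᴵ (g y) true + ∑ᴵ (g y) false)
        ≡⟨ cong₂ _+_ (sym (∑ʷ-suc (suc m) n (f ∘ liftV))) (∑ₗ-+ (I true) (I false) (letters n)) ⟩
      ∑ʷ (suc (suc m)) n (f ∘ liftV) + (∑ᴸ n (I true) + ∑ᴸ n (I false))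
        ≡⟨ cong (∑ʷ (suc (suc m)) n (f ∘ liftV) +_) (cong₂ _+_ (shift true) (shift false)) ⟩
      ∑ʷ (suc (suc m)) n (f ∘ liftV) + (∑ᴵ′ f true + ∑ᴵ′ f false) ∎
      where
      g : Letter n → Vec (Letter (suc n)) (suc m) → ℕ
      g y = f ∘ (lift y ∷ᵥ_)
      I : Bool → Letter n → ℕ
      I b y = ∑ᴵ (g y) b
      shift : ∀ b → ∑ᴸ n (I b) ≡ ∑ᴵ′ f b
      shift b = trans (∑ₗ-∑-comm (λ p y → ∑ʷ m n (g y ∘ insertOne p b)) (letters n))
                      (sum-cong-≗ (λ p → sym (∑ʷ-suc m n (f ∘ insertOne (fsuc p) b))))

  ∑ʷ-pigeonhole : ∀ n m (f : Vec (Letter n) m → ℕ) → (∀ v → ¬ Distinct v → f v ≡ 0) →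
                  n < m → ∑ʷ m n f ≡ 0
  ∑ʷ-pigeonhole zero    (suc m) f _        _         = refl
  ∑ʷ-pigeonhole (suc n) (suc m) f f-vanish (s≤s n<m) = begin
    ∑ʷ (suc m) (suc n) f
      ≡⟨ ∑ʷ-split n m f f-vanish ⟩
    ∑ʷ (suc m) n (f ∘ liftV) + (∑ᴵ f true + ∑ᴵ f false)
      ≡⟨ cong₂ _+_ lifted (cong₂ _+_ (inserted true) (inserted false)) ⟩
    0 ∎
    where
    lifted : ∑ʷ (suc m) n (f ∘ liftV) ≡ 0
    lifted = ∑ʷ-pigeonhole n (suc m) (f ∘ liftV)
               (λ u nd → f-vanish _ (nd ∘ Distinct-liftV⁻ u)) (ℕP.m<n⇒m<1+n n<m)
    inserted : ∀ b → ∑ᴵ f b ≡ 0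
    inserted b = trans (sum-cong-≗ (λ p → ∑ʷ-pigeonhole n m (f ∘ insertOne p b)
                         (λ u nd → f-vanish _ (nd ∘ Distinct-insertOne⁻ u p b)) n<m))
                       (sum-replicate-zero (suc m))

  𝟙 : {A : Set} → Dec A → ℕ
  𝟙 a? = if isYes a? then 1 else 0

  𝟙-yes : {A : Set} (a? : Dec A) → A → 𝟙 a? ≡ 1
  𝟙-yes (yes _) _ = refl
  𝟙-yes (no ¬a) a = ⊥-elim (¬a a)

  𝟙-no : {A : Set} (a? : Dec A) → ¬ A → 𝟙 a? ≡ 0
  𝟙-no (yes a) ¬a = ⊥-elim (¬a a)
  𝟙-no (no _)  _  = refl

  𝟙-suc-< : ∀ a b → 𝟙 (suc a <? suc b) ≡ 𝟙 (a <? b)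
  𝟙-suc-< a b with a <? b
  ... | yes a<b = 𝟙-yes (suc a <? suc b) (s≤s a<b)
  ... | no  a≮b = 𝟙-no (suc a <? suc b) (a≮b ∘ ℕP.≤-pred)

  descent : ∀ {n} → Letter n → Letter n → ℕ
  descent x y = 𝟙 (rank y <? rank x)

  descents : ∀ {n m} → Vec (Letter n) m → ℕ
  descents v = desList (toList v)

  descents-∷∷ : ∀ {n m} (x y : Letter n) (v : Vec (Letter n) m) →
                descents (x ∷ᵥ y ∷ᵥ v) ≡ descent x y + descents (y ∷ᵥ v)
  descents-∷∷ (true  , _) y v = refl
  descents-∷∷ (false , _) y v = refl

  rank-lift : ∀ {n} (a : Letter n) → rank (lift a) ≡ suc (rank a)
  rank-lift (true  , k) = refl
  rank-lift {n} (false , k) = begin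
    (2 * suc n ∸ 1) ∸ suc t  ≡⟨ cong (λ x → (x ∸ 1) ∸ suc t) (ℕP.*-suc 2 n) ⟩
    suc (2 * n) ∸ suc t      ≡⟨ ℕP.+-∸-assoc 1 t<2n ⟩
    suc (2 * n ∸ suc t)      ≡⟨ cong suc (ℕP.∸-+-assoc (2 * n) 1 t) ⟨
    suc ((2 * n ∸ 1) ∸ t)    ∎
    where
    t = toℕ k
    t<2n : t < 2 * n
    t<2n = ℕP.≤-trans (FinP.toℕ<n k) (ℕP.m≤m+n n (n + 0))

  rank-lift<rank-−1 : ∀ {n} (a : Letter n) → rank (lift a) < rank (±1 {n} false)
  rank-lift<rank-−1 {n} a =
    subst₂ _<_ (sym (rank-lift a)) (cong (_∸ 1) (sym (ℕP.*-suc 2 n))) (s≤s (rank<2n a))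
    where
    rank<2n : ∀ {n} (a : Letter n) → rank a < 2 * n
    rank<2n {n}     (true  , k) = ℕP.≤-trans (FinP.toℕ<n k) (ℕP.m≤m+n n (n + 0))
    rank<2n {suc n} (false , k) = s≤s (ℕP.m∸n≤m _ (toℕ k))

  descent-lift : ∀ {n} (a b : Letter n) → descent (lift a) (lift b) ≡ descent a b
  descent-lift a b =
    trans (cong₂ (λ x y → 𝟙 (y <? x)) (rank-lift a) (rank-lift b)) (𝟙-suc-< (rank b) (rank a))

  descent-lift-+1 : ∀ {n} (a : Letter n) → descent (lift a) (±1 true) ≡ 1
  descent-lift-+1 a = 𝟙-yes (_ <? _) (subst (0 <_) (sym (rank-lift a)) (s≤s z≤n))

  descent-lift-−1 : ∀ {n} (a : Letter n) → descent (lift a) (±1 false) ≡ 0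
  descent-lift-−1 a = 𝟙-no (_ <? _) (ℕP.<-asym (rank-lift<rank-−1 a))

  descent-−1-lift : ∀ {n} (a : Letter n) → descent (±1 false) (lift a) ≡ 1
  descent-−1-lift a = 𝟙-yes (_ <? _) (rank-lift<rank-−1 a)

  descents-liftV : ∀ {n m} (u : Vec (Letter n) m) → descents (liftV u) ≡ descents u
  descents-liftV []ᵥ                  = refl
  descents-liftV ((true  , _) ∷ᵥ []ᵥ) = refl
  descents-liftV ((false , _) ∷ᵥ []ᵥ) = refl
  descents-liftV (x ∷ᵥ y ∷ᵥ v)        = begin
    descents (lift x ∷ᵥ lift y ∷ᵥ liftV v)
      ≡⟨ descents-∷∷ (lift x) (lift y) (liftV v) ⟩
    descent (lift x) (lift y) + descents (liftV (y ∷ᵥ v))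
      ≡⟨ cong₂ _+_ (descent-lift x y) (descents-liftV (y ∷ᵥ v)) ⟩
    descent x y + descents (y ∷ᵥ v)
      ≡⟨ descents-∷∷ x y v ⟨
    descents (x ∷ᵥ y ∷ᵥ v) ∎

  descents-insertOne-front-+1 : ∀ {n m} (u : Vec (Letter n) m) → descents (insertOne fzero true u) ≡ descents u
  descents-insertOne-front-+1 []ᵥ       = refl
  descents-insertOne-front-+1 (x ∷ᵥ u) = descents-liftV (x ∷ᵥ u)

  descents-insertOne-front-−1 : ∀ {n m} (u : Vec (Letter n) m) →
                                descents (insertOne fzero false u) ≡ suc (descents u)
  descents-insertOne-front-−1 []ᵥ       = refl
  descents-insertOne-front-−1 (x ∷ᵥ u) = cong₂ _+_ (descent-−1-lift x) (descents-liftV (x ∷ᵥ u))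

  -- descentAt q u is 1 iff u has a descent at position q + 1 (in the 1-based numbering of the paper).
  descentAt : ∀ {n m} → Fin m → Vec (Letter n) m → ℕ
  descentAt fzero    (x ∷ᵥ y ∷ᵥ _)        = descent x y
  descentAt fzero    ((true  , _) ∷ᵥ []ᵥ) = 0
  descentAt fzero    ((false , _) ∷ᵥ []ᵥ) = 1
  descentAt (fsuc q) (_ ∷ᵥ v)             = descentAt q v

  descentAt≤1 : ∀ {n m} (q : Fin m) (u : Vec (Letter n) m) → descentAt q u ≤ 1
  descentAt≤1 fzero    ((true  , _) ∷ᵥ []ᵥ) = z≤n
  descentAt≤1 fzero    ((false , _) ∷ᵥ []ᵥ) = s≤s z≤n
  descentAt≤1 fzero    (x ∷ᵥ y ∷ᵥ _)        = 𝟙≤1 (rank y <? rank x)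
    where
    𝟙≤1 : {A : Set} (a? : Dec A) → 𝟙 a? ≤ 1
    𝟙≤1 (yes _) = s≤s z≤n
    𝟙≤1 (no _)  = z≤n
  descentAt≤1 (fsuc q) (_ ∷ᵥ v)             = descentAt≤1 q v

  descents≡∑descentAt : ∀ {n m} (u : Vec (Letter n) m) → descents u ≡ ∑[ q < m ] descentAt q u
  descents≡∑descentAt []ᵥ                  = refl
  descents≡∑descentAt ((true  , _) ∷ᵥ []ᵥ) = refl
  descents≡∑descentAt ((false , _) ∷ᵥ []ᵥ) = refl
  descents≡∑descentAt (x ∷ᵥ y ∷ᵥ v)        =
    trans (descents-∷∷ x y v) (cong (descent x y +_) (descents≡∑descentAt (y ∷ᵥ v)))

  descents-insertOne-suc : ∀ {n m} (q : Fin m) b (u : Vec (Letter n) m) →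
                           descents (insertOne (fsuc q) b u) + descentAt q u ≡ suc (descents u)
  descents-insertOne-suc fzero b (x ∷ᵥ []ᵥ) = begin
    descents (lift x ∷ᵥ ±1 b ∷ᵥ []ᵥ) + descentAt fzero (x ∷ᵥ []ᵥ)
      ≡⟨ cong (_+ descentAt fzero (x ∷ᵥ []ᵥ)) (descents-∷∷ (lift x) (±1 b) []ᵥ) ⟩
    (descent (lift x) (±1 b) + descents (±1 b ∷ᵥ []ᵥ)) + descentAt fzero (x ∷ᵥ []ᵥ)
      ≡⟨ cong₂ _+_ (one-at-end b) (final-sign x) ⟩
    suc (descents (x ∷ᵥ []ᵥ)) ∎
    where
    one-at-end : ∀ b → descent (lift x) (±1 b) + descents (±1 b ∷ᵥ []ᵥ) ≡ 1
    one-at-end true  = cong (_+ 0) (descent-lift-+1 x)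
    one-at-end false = cong (_+ 1) (descent-lift-−1 x)
    final-sign : ∀ x → descentAt fzero (x ∷ᵥ []ᵥ) ≡ descents (x ∷ᵥ []ᵥ)
    final-sign (true  , _) = refl
    final-sign (false , _) = refl
  descents-insertOne-suc fzero b (x ∷ᵥ y ∷ᵥ v) = begin
    descents (lift x ∷ᵥ ±1 b ∷ᵥ lift y ∷ᵥ liftV v) + descent x y
      ≡⟨ cong (_+ descent x y) (trans (descents-∷∷ (lift x) (±1 b) _)
                                      (cong (_ +_) (descents-∷∷ (±1 b) (lift y) _))) ⟩
    (descent (lift x) (±1 b) + (descent (±1 b) (lift y) + descents (liftV (y ∷ᵥ v)))) + descent x y
      ≡⟨ cong (_+ descent x y) (trans (sym (ℕP.+-assoc (descent (lift x) (±1 b)) _ _))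
                                      (cong₂ _+_ (one-around b) (descents-liftV (y ∷ᵥ v)))) ⟩
    suc (descents (y ∷ᵥ v)) + descent x y
      ≡⟨ cong suc (ℕP.+-comm (descents (y ∷ᵥ v)) (descent x y)) ⟩
    suc (descent x y + descents (y ∷ᵥ v))
      ≡⟨ cong suc (descents-∷∷ x y v) ⟨
    suc (descents (x ∷ᵥ y ∷ᵥ v)) ∎
    where
    one-around : ∀ b → descent (lift x) (±1 b) + descent (±1 b) (lift y) ≡ 1
    one-around true  = cong (_+ 0) (descent-lift-+1 x)
    one-around false = cong₂ _+_ (descent-lift-−1 x) (descent-−1-lift y)
  descents-insertOne-suc (fsuc q) b (x ∷ᵥ y ∷ᵥ v) = begin
    descents (lift x ∷ᵥ insertOne (fsuc q) b (y ∷ᵥ v)) + descentAt q (y ∷ᵥ v)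
      ≡⟨ cong (_+ descentAt q (y ∷ᵥ v)) (descents-∷∷ (lift x) (lift y) (insertAt (liftV v) q (±1 b))) ⟩
    (descent (lift x) (lift y) + descents (insertOne (fsuc q) b (y ∷ᵥ v))) + descentAt q (y ∷ᵥ v)
      ≡⟨ ℕP.+-assoc (descent (lift x) (lift y)) _ _ ⟩
    descent (lift x) (lift y) + (descents (insertOne (fsuc q) b (y ∷ᵥ v)) + descentAt q (y ∷ᵥ v))
      ≡⟨ cong₂ _+_ (descent-lift x y) (descents-insertOne-suc q b (y ∷ᵥ v)) ⟩
    descent x y + suc (descents (y ∷ᵥ v))
      ≡⟨ ℕP.+-suc (descent x y) _ ⟩
    suc (descent x y + descents (y ∷ᵥ v))
      ≡⟨ cong suc (descents-∷∷ x y v) ⟨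
    suc (descents (x ∷ᵥ y ∷ᵥ v)) ∎

  ∑-complement : ∀ {m} (a : Fin m → ℕ) → (∀ q → a q ≤ 1) → ∑[ q < m ] (1 ∸ a q) ≡ m ∸ ∑[ q < m ] a q
  ∑-complement {m} a a≤1 = begin
    ∑[ q < m ] (1 ∸ a q)
      ≡⟨ ℕP.m+n∸n≡m _ A ⟨
    ∑[ q < m ] (1 ∸ a q) + A ∸ A
      ≡⟨ cong (_∸ A) (∑-distrib-+ (λ q → 1 ∸ a q) a) ⟨
    ∑[ q < m ] (1 ∸ a q + a q) ∸ A
      ≡⟨ cong (_∸ A) (trans (sum-cong-≗ (λ q → ℕP.m∸n+n≡m (a≤1 q))) (ones m)) ⟩
    m ∸ A ∎
    where
    A = ∑[ q < m ] a q
    ones : ∀ m → ∑[ q < m ] 1 ≡ m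
    ones zero    = refl
    ones (suc m) = cong suc (ones m)

  select-by-bit : ∀ (φ : ℕ → ℕ) {e a d} → a ≤ 1 → e + a ≡ suc d →
                  φ e ≡ a * φ d + (1 ∸ a) * φ (suc d)
  select-by-bit φ {e} {d = d} z≤n e+0≡1+d = begin
    φ e                ≡⟨ cong φ (trans (sym (ℕP.+-identityʳ e)) e+0≡1+d) ⟩
    φ (suc d)          ≡⟨ ℕP.+-identityʳ (φ (suc d)) ⟨
    1 * φ (suc d)      ∎
  select-by-bit φ {e} {d = d} (s≤s z≤n) e+1≡1+d = begin
    φ e                ≡⟨ cong φ (ℕP.suc-injective (trans (ℕP.+-comm 1 e) e+1≡1+d)) ⟩
    φ d                ≡⟨ trans (ℕP.+-identityʳ _) (ℕP.+-identityʳ (φ d)) ⟨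
    1 * φ d + 0 * φ (suc d) ∎

  insertionSum : ∀ {n m} → (ℕ → ℕ) → Vec (Letter n) m → ℕ
  insertionSum {m = m} φ u =
    ∑[ p < suc m ] (φ (descents (insertOne p true u)) + φ (descents (insertOne p false u)))

  insertionSum≡ : ∀ {n m} (φ : ℕ → ℕ) (u : Vec (Letter n) m) → insertionSum φ u
    ≡ (2 * descents u + 1) * φ (descents u) + (2 * (m ∸ descents u) + 1) * φ (suc (descents u))
  insertionSum≡ {n} {m} φ u = begin
    (φ (descents (insertOne fzero true u)) + φ (descents (insertOne fzero false u))) + ∑[ q < m ] (F true q + F false q)
      ≡⟨ cong₂ _+_ (cong₂ _+_ (cong φ (descents-insertOne-front-+1 u)) (cong φ (descents-insertOne-front-−1 u)))
                   (sum-cong-≗ (λ q → cong₂ _+_ (select true q) (select false q))) ⟩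
    (φ d + φ (suc d)) + ∑[ q < m ] (S q + S q)
      ≡⟨ cong (φ d + φ (suc d) +_) (trans (∑-distrib-+ S S) (cong (λ s → s + s) ∑S)) ⟩
    (φ d + φ (suc d)) + ((d * φ d + (m ∸ d) * φ (suc d)) + (d * φ d + (m ∸ d) * φ (suc d)))
      ≡⟨ collect d (m ∸ d) (φ d) (φ (suc d)) ⟩
    (2 * d + 1) * φ d + (2 * (m ∸ d) + 1) * φ (suc d) ∎
    where
    d = descents u
    a : Fin m → ℕ
    a q = descentAt q u
    F : Bool → Fin m → ℕ
    F b q = φ (descents (insertOne (fsuc q) b u))
    S : Fin m → ℕ
    S q = a q * φ d + (1 ∸ a q) * φ (suc d)
    select : ∀ b q → F b q ≡ S q
    select b q = select-by-bit φ (descentAt≤1 q u) (descents-insertOne-suc q b u)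
    ∑a : ∑[ q < m ] a q ≡ d
    ∑a = sym (descents≡∑descentAt u)
    ∑1∸a : ∑[ q < m ] (1 ∸ a q) ≡ m ∸ d
    ∑1∸a = trans (∑-complement a (λ q → descentAt≤1 q u)) (cong (m ∸_) ∑a)
    ∑S : ∑[ q < m ] S q ≡ d * φ d + (m ∸ d) * φ (suc d)
    ∑S = begin
      ∑[ q < m ] S q
        ≡⟨ ∑-distrib-+ (λ q → a q * φ d) (λ q → (1 ∸ a q) * φ (suc d)) ⟩
      ∑[ q < m ] (a q * φ d) + ∑[ q < m ] ((1 ∸ a q) * φ (suc d))
        ≡⟨ cong₂ _+_ (*-distribʳ-sum (φ d) a) (*-distribʳ-sum (φ (suc d)) (λ q → 1 ∸ a q)) ⟨
      ∑[ q < m ] a q * φ d + ∑[ q < m ] (1 ∸ a q) * φ (suc d)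
        ≡⟨ cong₂ (λ x y → x * φ d + y * φ (suc d)) ∑a ∑1∸a ⟩
      d * φ d + (m ∸ d) * φ (suc d) ∎
    collect : ∀ d e x y → (x + y) + ((d * x + e * y) + (d * x + e * y)) ≡ (2 * d + 1) * x + (2 * e + 1) * y
    collect = solve-∀

  length-filter : ∀ {A : Set} {P : A → Set} (P? : Decidable P) xs →
                  length (filter P? xs) ≡ ∑ₗ (𝟙 ∘ P?) xs
  length-filter P? []       = refl
  length-filter P? (x ∷ xs) with P? x
  ... | yes _ = cong suc (length-filter P? xs)
  ... | no  _ = length-filter P? xs

  ∑ₗ-filter : ∀ {A : Set} {P : A → Set} (P? : Decidable P) (f : A → ℕ) xs →
              ∑ₗ f (filter P? xs) ≡ ∑ₗ (λ x → 𝟙 (P? x) * f x) xs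
  ∑ₗ-filter P? f []       = refl
  ∑ₗ-filter P? f (x ∷ xs) with P? x
  ... | yes _ = cong₂ _+_ (sym (ℕP.+-identityʳ (f x))) (∑ₗ-filter P? f xs)
  ... | no  _ = ∑ₗ-filter P? f xs

  𝟙-cong : {A B : Set} (a? : Dec A) (b? : Dec B) → (A → B) → (B → A) → 𝟙 a? ≡ 𝟙 b?
  𝟙-cong (yes _) (yes _) _   _   = refl
  𝟙-cong (yes a) (no ¬b) a→b _   = ⊥-elim (¬b (a→b a))
  𝟙-cong (no ¬a) (yes b) _   b→a = ⊥-elim (¬a (b→a b))
  𝟙-cong (no _)  (no _)  _   _   = refl

  𝟙-suc-≟ : ∀ a b → 𝟙 (suc a ≟ suc b) ≡ 𝟙 (a ≟ b)
  𝟙-suc-≟ a b = 𝟙-cong (suc a ≟ suc b) (a ≟ b) ℕP.suc-injective (cong suc)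

  𝟙≟-weight : ∀ (c : ℕ → ℕ) d k → c d * 𝟙 (d ≟ k) ≡ c k * 𝟙 (d ≟ k)
  𝟙≟-weight c d k with d ≟ k
  ... | yes refl = refl
  ... | no  _    = trans (ℕP.*-zeroʳ (c d)) (sym (ℕP.*-zeroʳ (c k)))

  weight : ∀ {n} → ℕ → Vec (Letter n) n → ℕ
  weight k v = 𝟙 (isSignedPerm? v) * 𝟙 (des v ≟ k)

  signedEulerian≡∑ʷ : ∀ n k → signedEulerian n k ≡ ∑ʷ n n (weight k)
  signedEulerian≡∑ʷ n k =
    trans (length-filter (λ v → des v ≟ k) (signedPerms n))
          (∑ₗ-filter isSignedPerm? (λ v → 𝟙 (des v ≟ k)) (words n (letters n)))

  weight-nonperm : ∀ {n} k (v : Vec (Letter n) n) → ¬ Distinct v → weight k v ≡ 0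
  weight-nonperm k v nd = cong (_* 𝟙 (des v ≟ k)) (𝟙-no (isSignedPerm? v) nd)

  weight-insertOne : ∀ {n} k p b (u : Vec (Letter n) n) →
                     weight k (insertOne p b u) ≡ 𝟙 (isSignedPerm? u) * 𝟙 (descents (insertOne p b u) ≟ k)
  weight-insertOne k p b u =
    cong (_* 𝟙 (descents (insertOne p b u) ≟ k))
         (𝟙-cong (isSignedPerm? _) (isSignedPerm? u) (Distinct-insertOne⁻ u p b) (Distinct-insertOne⁺ u p b))

  signedEulerian-suc : ∀ n k → signedEulerian (suc n) k
    ≡ ∑ʷ n n (λ u → 𝟙 (isSignedPerm? u) * insertionSum (λ d → 𝟙 (d ≟ k)) u)
  signedEulerian-suc n k = begin
    signedEulerian (suc n) k
      ≡⟨ signedEulerian≡∑ʷ (suc n) k ⟩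
    ∑ʷ (suc n) (suc n) (weight k)
      ≡⟨ ∑ʷ-split n n (weight k) (weight-nonperm k) ⟩
    ∑ʷ (suc n) n (weight k ∘ liftV) + (I true + I false)
      ≡⟨ cong (_+ (I true + I false)) no-lifted-perms ⟩
    I true + I false
      ≡⟨ ∑-distrib-+ (λ p → ∑ʷ n n (W p true)) (λ p → ∑ʷ n n (W p false)) ⟨
    ∑[ p < suc n ] (∑ʷ n n (W p true) + ∑ʷ n n (W p false))
      ≡⟨ sum-cong-≗ (λ p → trans (sym (∑ʷ-+ n n (W p true) (W p false))) (∑ʷ-cong n n (both-signs p))) ⟩
    ∑[ p < suc n ] ∑ʷ n n (λ u → 𝟙 (isSignedPerm? u) * Φ p u)
      ≡⟨ ∑ₗ-∑-comm (λ p u → 𝟙 (isSignedPerm? u) * Φ p u) (words n (letters n)) ⟨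
    ∑ʷ n n (λ u → ∑[ p < suc n ] (𝟙 (isSignedPerm? u) * Φ p u))
      ≡⟨ ∑ʷ-cong n n (λ u → sym (*-distribˡ-sum (𝟙 (isSignedPerm? u)) (λ p → Φ p u))) ⟩
    ∑ʷ n n (λ u → 𝟙 (isSignedPerm? u) * insertionSum (λ d → 𝟙 (d ≟ k)) u) ∎
    where
    I : Bool → ℕ
    I = ∑ᴵ {n} {n} (weight k)
    W : Fin (suc n) → Bool → Vec (Letter n) n → ℕ
    W p b = weight k ∘ insertOne p b
    Φ : Fin (suc n) → Vec (Letter n) n → ℕ
    Φ p u = 𝟙 (descents (insertOne p true u) ≟ k) + 𝟙 (descents (insertOne p false u) ≟ k)
    no-lifted-perms : ∑ʷ (suc n) n (weight {suc n} k ∘ liftV) ≡ 0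
    no-lifted-perms = ∑ʷ-pigeonhole n (suc n) (weight k ∘ liftV)
                        (λ u nd → weight-nonperm k (liftV u) (nd ∘ Distinct-liftV⁻ u)) (ℕP.n<1+n n)
    both-signs : ∀ p u → W p true u + W p false u ≡ 𝟙 (isSignedPerm? u) * Φ p u
    both-signs p u = trans (cong₂ _+_ (weight-insertOne k p true u) (weight-insertOne k p false u))
                           (sym (ℕP.*-distribˡ-+ (𝟙 (isSignedPerm? u)) _ _))

  signedEulerian-suc-zero : ∀ n → signedEulerian (suc n) 0 ≡ signedEulerian n 0
  signedEulerian-suc-zero n = begin
    signedEulerian (suc n) 0
      ≡⟨ signedEulerian-suc n 0 ⟩
    ∑ʷ n n (λ u → 𝟙 (isSignedPerm? u) * insertionSum (λ d → 𝟙 (d ≟ 0)) u)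
      ≡⟨ ∑ʷ-cong n n only-unchanged ⟩
    ∑ʷ n n (weight 0)
      ≡⟨ signedEulerian≡∑ʷ n 0 ⟨
    signedEulerian n 0 ∎
    where
    simplify : ∀ p x c → p * ((2 * 0 + 1) * x + c * 0) ≡ p * x
    simplify = solve-∀
    only-unchanged : ∀ u → 𝟙 (isSignedPerm? u) * insertionSum (λ d → 𝟙 (d ≟ 0)) u ≡ weight 0 u
    only-unchanged u = begin
      𝟙 (isSignedPerm? u) * insertionSum (λ d → 𝟙 (d ≟ 0)) u
        ≡⟨ cong (𝟙 (isSignedPerm? u) *_) (insertionSum≡ (λ d → 𝟙 (d ≟ 0)) u) ⟩
      𝟙 (isSignedPerm? u) * ((2 * des u + 1) * 𝟙 (des u ≟ 0) + (2 * (n ∸ des u) + 1) * 0)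
        ≡⟨ cong (λ x → 𝟙 (isSignedPerm? u) * (x + (2 * (n ∸ des u) + 1) * 0))
                (𝟙≟-weight (λ d → 2 * d + 1) (des u) 0) ⟩
      𝟙 (isSignedPerm? u) * ((2 * 0 + 1) * 𝟙 (des u ≟ 0) + (2 * (n ∸ des u) + 1) * 0)
        ≡⟨ simplify (𝟙 (isSignedPerm? u)) (𝟙 (des u ≟ 0)) (2 * (n ∸ des u) + 1) ⟩
      weight 0 u ∎

  signedEulerian-suc-suc : ∀ n k → signedEulerian (suc n) (suc k)
    ≡ (2 * suc k + 1) * signedEulerian n (suc k) + (2 * (n ∸ k) + 1) * signedEulerian n k
  signedEulerian-suc-suc n k = begin
    signedEulerian (suc n) (suc k)
      ≡⟨ signedEulerian-suc n (suc k) ⟩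
    ∑ʷ n n (λ u → 𝟙 (isSignedPerm? u) * insertionSum (λ d → 𝟙 (d ≟ suc k)) u)
      ≡⟨ ∑ʷ-cong n n split-by-old-descents ⟩
    ∑ʷ n n (λ u → a * weight (suc k) u + b * weight k u)
      ≡⟨ ∑ʷ-+ n n _ _ ⟩
    ∑ʷ n n (λ u → a * weight (suc k) u) + ∑ʷ n n (λ u → b * weight k u)
      ≡⟨ cong₂ _+_ (∑ʷ-* n n a (weight (suc k))) (∑ʷ-* n n b (weight k)) ⟩
    a * ∑ʷ n n (weight (suc k)) + b * ∑ʷ n n (weight k)
      ≡⟨ cong₂ (λ x y → a * x + b * y) (signedEulerian≡∑ʷ n (suc k)) (signedEulerian≡∑ʷ n k) ⟨
    a * signedEulerian n (suc k) + b * signedEulerian n k ∎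
    where
    a = 2 * suc k + 1
    b = 2 * (n ∸ k) + 1
    distribute : ∀ p a b x y → p * (a * x + b * y) ≡ a * (p * x) + b * (p * y)
    distribute = solve-∀
    split-by-old-descents : ∀ u → 𝟙 (isSignedPerm? u) * insertionSum (λ d → 𝟙 (d ≟ suc k)) u
                                  ≡ a * weight (suc k) u + b * weight k u
    split-by-old-descents u = begin
      𝟙 (isSignedPerm? u) * insertionSum (λ d → 𝟙 (d ≟ suc k)) u
        ≡⟨ cong (𝟙 (isSignedPerm? u) *_) (insertionSum≡ (λ d → 𝟙 (d ≟ suc k)) u) ⟩
      𝟙 (isSignedPerm? u) * ((2 * des u + 1) * 𝟙 (des u ≟ suc k) + (2 * (n ∸ des u) + 1) * 𝟙 (suc (des u) ≟ suc k))
        ≡⟨ cong₂ (λ x y → 𝟙 (isSignedPerm? u) * (x + y))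
                 (𝟙≟-weight (λ d → 2 * d + 1) (des u) (suc k))
                 (trans (cong ((2 * (n ∸ des u) + 1) *_) (𝟙-suc-≟ (des u) k))
                        (𝟙≟-weight (λ d → 2 * (n ∸ d) + 1) (des u) k)) ⟩
      𝟙 (isSignedPerm? u) * (a * 𝟙 (des u ≟ suc k) + b * 𝟙 (des u ≟ k))
        ≡⟨ distribute (𝟙 (isSignedPerm? u)) a b (𝟙 (des u ≟ suc k)) (𝟙 (des u ≟ k)) ⟩
      a * weight (suc k) u + b * weight k u ∎

  signedEulerian-zero : ∀ n → signedEulerian n 0 ≡ 1
  signedEulerian-zero zero    = refl
  signedEulerian-zero (suc n) = trans (signedEulerian-suc-zero n) (signedEulerian-zero n)

  signedEulerian-beyond : ∀ n k → n < k → signedEulerian n k ≡ 0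
  signedEulerian-beyond zero    (suc k) _         = refl
  signedEulerian-beyond (suc n) (suc k) (s≤s n<k) = begin
    signedEulerian (suc n) (suc k)
      ≡⟨ signedEulerian-suc-suc n k ⟩
    (2 * suc k + 1) * signedEulerian n (suc k) + (2 * (n ∸ k) + 1) * signedEulerian n k
      ≡⟨ cong₂ (λ x y → (2 * suc k + 1) * x + (2 * (n ∸ k) + 1) * y)
               (signedEulerian-beyond n (suc k) (ℕP.m<n⇒m<1+n n<k)) (signedEulerian-beyond n k n<k) ⟩
    (2 * suc k + 1) * 0 + (2 * (n ∸ k) + 1) * 0
      ≡⟨ annihilate (2 * suc k + 1) (2 * (n ∸ k) + 1) ⟩
    0 ∎
    where
    annihilate : ∀ a b → a * 0 + b * 0 ≡ 0
    annihilate = solve-∀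

  signedEulerian-suc-diagonal : ∀ n → signedEulerian (suc n) (suc n) ≡ signedEulerian n n
  signedEulerian-suc-diagonal n = begin
    signedEulerian (suc n) (suc n)
      ≡⟨ signedEulerian-suc-suc n n ⟩
    (2 * suc n + 1) * signedEulerian n (suc n) + (2 * (n ∸ n) + 1) * signedEulerian n n
      ≡⟨ cong₂ (λ x y → (2 * suc n + 1) * x + (2 * y + 1) * signedEulerian n n)
               (signedEulerian-beyond n (suc n) (ℕP.n<1+n n)) (ℕP.n∸n≡0 n) ⟩
    (2 * suc n + 1) * 0 + (2 * 0 + 1) * signedEulerian n n
      ≡⟨ simplify (2 * suc n + 1) (signedEulerian n n) ⟩
    signedEulerian n n ∎
    where
    simplify : ∀ a x → a * 0 + (2 * 0 + 1) * x ≡ x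
    simplify = solve-∀

open import Data.Nat as ℕ using (ℕ; zero; suc; _≤_; _∸_; s≤s; z≤n)
import Data.Nat.Properties as ℕP
open import Data.Integer using (ℤ; +_; -_; _-_; _^_; _+_; _*_)
import Data.Integer.Properties as ℤP
open import Data.Product using (_×_; _,_)
open import Data.Sum using (inj₁; inj₂)
open import Relation.Binary.PropositionalEquality using (_≡_; refl; sym; trans; cong; cong₂; module ≡-Reasoning)
open AlternatingSums using (w-pascal; w-top; w-zero-zero; w-zero-suc)
open SignedPermutations using (signedEulerian-zero; signedEulerian-suc-suc; signedEulerian-suc-diagonal)

open ≡-Reasoning

w≡signedEulerian : ∀ n k → k ≤ n → w n 0 k ≡ + signedEulerian n k
w≡signedEulerian n       zero    _         = trans (w-zero-zero n) (cong +_ (sym (signedEulerian-zero n)))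
w≡signedEulerian (suc n) (suc k) (s≤s k≤n) with ℕP.m≤n⇒m<n∨m≡n k≤n
... | inj₁ k<n = begin
  w (suc n) 0 (suc k)
    ≡⟨ w-zero-suc n k k≤n ⟩
  + a * w n 0 (suc k) + + b * w n 0 k
    ≡⟨ cong₂ (λ x y → + a * x + + b * y) (w≡signedEulerian n (suc k) k<n) (w≡signedEulerian n k k≤n) ⟩
  + a * + signedEulerian n (suc k) + + b * + signedEulerian n k
    ≡⟨ cong₂ _+_ (ℤP.pos-* a _) (ℤP.pos-* b _) ⟨
  + (a ℕ.* signedEulerian n (suc k)) + + (b ℕ.* signedEulerian n k)
    ≡⟨ ℤP.pos-+ (a ℕ.* signedEulerian n (suc k)) (b ℕ.* signedEulerian n k) ⟨
  + (a ℕ.* signedEulerian n (suc k) ℕ.+ b ℕ.* signedEulerian n k)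
    ≡⟨ cong +_ (signedEulerian-suc-suc n k) ⟨
  + signedEulerian (suc n) (suc k) ∎
  where
  a = 2 ℕ.* suc k ℕ.+ 1
  b = 2 ℕ.* (n ∸ k) ℕ.+ 1
... | inj₂ refl = begin
  w (suc k) 0 (suc k)              ≡⟨ w-top (suc k) 0 z≤n ⟩
  + 1                              ≡⟨ w-top k 0 z≤n ⟨
  w k 0 k                          ≡⟨ w≡signedEulerian k k k≤n ⟩
  + signedEulerian k k             ≡⟨ cong +_ (signedEulerian-suc-diagonal k) ⟨
  + signedEulerian (suc k) (suc k) ∎

proposition3p2 : (n : ℕ) → 1 ≤ n →
    ((i j : ℕ) → 1 ≤ i → i ≤ n → 1 ≤ j → j ≤ n →
      w n j i ≡ w (n ∸ 1) (j ∸ 1) i - w (n ∸ 1) (j ∸ 1) (i ∸ 1))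
    × ((i : ℕ) → i ≤ n → w n 0 i ≡ + signedEulerian n i)
    × ((j : ℕ) → j ≤ n → w n j n ≡ (- + 1) ^ j)
proposition3p2 (suc n) _ =
  (λ { (suc i) (suc j) _ _ _ _ → w-pascal n j i }) , w≡signedEulerian (suc n) , w-top (suc n)
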